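{- The language $Q_I$ is reflective: for all $x, y \in V^*$, if $xy \in Q_I$ then $yx \in Q_I$.
   Context: $V$ is a finite alphabet with at least two distinct letters; $V^*$ is the set of all finite words over $V$ (including the empty word). A nonempty word $w$ is primitive if it is not of the form $v^n$ for a word $v$ and an integer $n \ge 2$. For a word $w$ of length $n$, $w[1..i]$ denotes its prefix of length $i$ and $w[i+1..n]$ its suffix of length $n-i$. A primitive word $w$ of length $n$ is ins-robust if for every $i \in \{0,\ldots,n\}$ and every $a \in V$ the word $w[1..i]\,a\,w[i+1..n]$ is primitive; $Q_I$ is the set of ins-robust primitive words. A language $L \subseteq V^*$ is reflective if $uv \in L$ implies $vu \in L$ for all $u, v \in V^*$. -}

module Defs where

open import Data.Nat using (ℕ; zero; suc; _≤_)
open import Data.List using (List; []; _∷_; _++_; take; drop; length)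
open import Data.Product using (Σ; _×_; ∃₂)
open import Data.Empty using (⊥)
open import Relation.Nullary using (¬_)
open import Relation.Binary.PropositionalEquality using (_≡_)

Word : Set → Set
Word V = List V

_^ʷ_ : {V : Set} → Word V → ℕ → Word V
v ^ʷ zero = []
v ^ʷ suc n = v ++ (v ^ʷ n)

Primitive : {V : Set} → Word V → Set
Primitive w = ¬ (w ≡ []) × ¬ (∃₂ λ v n → (2 ≤ n) × (w ≡ v ^ʷ n))

insertAt : {V : Set} → ℕ → V → Word V → Word V
insertAt i a w = take i w ++ (a ∷ drop i w)

InsRobust : {V : Set} → Word V → Set
InsRobust {V} w = Primitive w × (∀ (i : ℕ) → i ≤ length w → ∀ (a : V) → Primitive (insertAt i a w))

Reflective : {V : Set} → (Word V → Set) → Set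
Reflective {V} L = ∀ (u v : Word V) → L (u ++ v) → L (v ++ u)

-- Rotating a proper power (v′b)ⁿ by its last letter gives the proper power (bv′)ⁿ, so
-- primitivity is invariant under rotation.  A letter inserted into a rotation zy of yz
-- lands either in z or in y; rotating back turns this into an insertion into yz itself,
-- so ins-robustness is invariant under rotation too.
module Submission where

open import Defs
open import Data.Nat using (ℕ; _≤_; zero; suc; s≤s; z≤n)
open import Data.Fin using (Fin)
open import Data.List using (List; []; _∷_; _++_; take; drop; length; _∷ʳ_; [_]; initLast; _∷ʳ′_)
open import Data.List.Properties using (∷-injective; ++-assoc; ++-identityʳ; take++drop≡id; ∷ʳ-injective)
open import Data.Product using (Σ-syntax; _×_; ∃₂; _,_)
open import Data.Sum using (_⊎_; inj₁; inj₂)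
open import Data.Empty using (⊥-elim)
open import Relation.Nullary using (¬_)
open import Relation.Binary.PropositionalEquality using (_≡_; refl; sym; trans; cong; subst; module ≡-Reasoning)

module _ {V : Set} where

  IsProperPower : Word V → Set
  IsProperPower w = ∃₂ λ v n → 2 ≤ n × w ≡ v ^ʷ n

  []^ʷ≡[] : ∀ n → ([] {A = V}) ^ʷ n ≡ []
  []^ʷ≡[] zero    = refl
  []^ʷ≡[] (suc n) = []^ʷ≡[] n

  ^ʷ-sucʳ : ∀ (v : Word V) n → v ^ʷ suc n ≡ v ^ʷ n ++ v
  ^ʷ-sucʳ v zero    = ++-identityʳ v
  ^ʷ-sucʳ v (suc n) = trans (cong (v ++_) (^ʷ-sucʳ v n)) (sym (++-assoc v (v ^ʷ n) v))

  ^ʷ-slide : ∀ (x y : Word V) n → (x ++ y) ^ʷ n ++ x ≡ x ++ (y ++ x) ^ʷ n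
  ^ʷ-slide x y zero    = sym (++-identityʳ x)
  ^ʷ-slide x y (suc n) = begin
    ((x ++ y) ++ (x ++ y) ^ʷ n) ++ x   ≡⟨ ++-assoc (x ++ y) _ x ⟩
    (x ++ y) ++ ((x ++ y) ^ʷ n ++ x)   ≡⟨ cong ((x ++ y) ++_) (^ʷ-slide x y n) ⟩
    (x ++ y) ++ (x ++ (y ++ x) ^ʷ n)   ≡⟨ ++-assoc x y _ ⟩
    x ++ (y ++ (x ++ (y ++ x) ^ʷ n))   ≡⟨ cong (x ++_) (sym (++-assoc y x _)) ⟩
    x ++ ((y ++ x) ++ (y ++ x) ^ʷ n)   ∎
    where open ≡-Reasoning

  ∷ʳ≢[] : ∀ (w : Word V) {a} → ¬ (w ∷ʳ a ≡ [])
  ∷ʳ≢[] []      ()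
  ∷ʳ≢[] (_ ∷ _) ()

  isProperPower-rotateʳ : ∀ a (w : Word V) → IsProperPower (w ∷ʳ a) → IsProperPower (a ∷ w)
  isProperPower-rotateʳ a w (v , suc m , 2≤1+m , eq) with initLast v
  ... | [] = ⊥-elim (∷ʳ≢[] w (trans eq ([]^ʷ≡[] (suc m))))
  ... | v′ ∷ʳ′ b with ∷ʳ-injective w ((v′ ∷ʳ b) ^ʷ m ++ v′) (begin
          w ∷ʳ a                        ≡⟨ eq ⟩
          (v′ ∷ʳ b) ^ʷ suc m            ≡⟨ ^ʷ-sucʳ (v′ ∷ʳ b) m ⟩
          (v′ ∷ʳ b) ^ʷ m ++ (v′ ∷ʳ b)   ≡⟨ sym (++-assoc _ v′ [ b ]) ⟩
          ((v′ ∷ʳ b) ^ʷ m ++ v′) ∷ʳ b   ∎)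
    where open ≡-Reasoning
  ... | refl , refl = b ∷ v′ , suc m , 2≤1+m , cong (b ∷_) (^ʷ-slide v′ [ b ] m)

  primitive-rotateˡ : ∀ a (w : Word V) → Primitive (a ∷ w) → Primitive (w ∷ʳ a)
  primitive-rotateˡ a w (_ , notPower) = ∷ʳ≢[] w , λ power → notPower (isProperPower-rotateʳ a w power)

  primitive-++-comm : ∀ (x y : Word V) → Primitive (x ++ y) → Primitive (y ++ x)
  primitive-++-comm []      y p = subst Primitive (sym (++-identityʳ y)) p
  primitive-++-comm (a ∷ x) y p =
    subst Primitive (++-assoc y [ a ] x)
      (primitive-++-comm x (y ∷ʳ a)
        (subst Primitive (++-assoc x y [ a ]) (primitive-rotateˡ a (x ++ y) p)))

  ++-≡-++-overlap : ∀ (v u p s : Word V) → v ++ u ≡ p ++ s →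
    (Σ[ m ∈ Word V ] p ≡ v ++ m × u ≡ m ++ s) ⊎ (Σ[ m ∈ Word V ] v ≡ p ++ m × s ≡ m ++ u)
  ++-≡-++-overlap []      u p       s eq = inj₁ (p , refl , eq)
  ++-≡-++-overlap (x ∷ v) u []      s eq = inj₂ (x ∷ v , refl , sym eq)
  ++-≡-++-overlap (x ∷ v) u (y ∷ p) s eq with ∷-injective eq
  ... | refl , eq′ with ++-≡-++-overlap v u p s eq′
  ... | inj₁ (m , p≡vm , u≡ms) = inj₁ (m , cong (x ∷_) p≡vm , u≡ms)
  ... | inj₂ (m , v≡pm , s≡mu) = inj₂ (m , cong (x ∷_) v≡pm , s≡mu)

  AllInsertionsPrimitive : Word V → Set
  AllInsertionsPrimitive w = ∀ p s c → w ≡ p ++ s → Primitive (p ++ c ∷ s)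

  insertAt-length-++ : ∀ c (p s : Word V) → insertAt (length p) c (p ++ s) ≡ p ++ c ∷ s
  insertAt-length-++ c []      s = refl
  insertAt-length-++ c (x ∷ p) s = cong (x ∷_) (insertAt-length-++ c p s)

  length-≤-++ : ∀ (p s : Word V) → length p ≤ length (p ++ s)
  length-≤-++ []      s = z≤n
  length-≤-++ (x ∷ p) s = s≤s (length-≤-++ p s)

  insRobust⇒allInsertionsPrimitive : ∀ w → InsRobust w → AllInsertionsPrimitive w
  insRobust⇒allInsertionsPrimitive w (_ , robust) p s c refl =
    subst Primitive (insertAt-length-++ c p s) (robust (length p) (length-≤-++ p s) c)

  allInsertionsPrimitive⇒insRobust : ∀ w → Primitive w → AllInsertionsPrimitive w → InsRobust w
  allInsertionsPrimitive⇒insRobust w prim all =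
    prim , λ i _ c → all (take i w) (drop i w) c (sym (take++drop≡id i w))

  allInsertionsPrimitive-++-comm : ∀ (u v : Word V) →
    AllInsertionsPrimitive (u ++ v) → AllInsertionsPrimitive (v ++ u)
  allInsertionsPrimitive-++-comm u v all p s c eq with ++-≡-++-overlap v u p s eq
  ... | inj₁ (m , refl , refl) =
    subst Primitive (sym (++-assoc v m (c ∷ s)))
      (primitive-++-comm (m ++ c ∷ s) v
        (subst Primitive (sym (++-assoc m (c ∷ s) v))
          (all m (s ++ v) c (++-assoc m s v))))
  ... | inj₂ (m , refl , refl) =
    subst Primitive (++-assoc p (c ∷ m) u)
      (primitive-++-comm u (p ++ c ∷ m)
        (subst Primitive (++-assoc u p (c ∷ m))
          (all (u ++ p) m c (sym (++-assoc u p m)))))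

theorem11 : (k : ℕ) → 2 ≤ k → Reflective {Fin k} InsRobust
theorem11 _ _ u v robust@(prim , _) =
  allInsertionsPrimitive⇒insRobust (v ++ u)
    (primitive-++-comm u v prim)
    (allInsertionsPrimitive-++-comm u v (insRobust⇒allInsertionsPrimitive (u ++ v) robust))
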